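{- A regular tournament is quadrangular if and only if it is out-quadrangular, and if and only if it is in-quadrangular. (Equivalently: for a regular tournament, being out-quadrangular, being in-quadrangular, and being quadrangular are all equivalent.)
   Context: A tournament is a loopless digraph in which for each pair of distinct vertices exactly one of $(u,v)$, $(v,u)$ is an arc; it is regular if all vertices have the same out-degree (so it has $2k+1$ vertices, each of out-degree $k$). $O(v)$ is the set of vertices $v$ beats and $I(v)$ the set of vertices beating $v$. A digraph is quadrangular if for all distinct $u,v$, $|O(u)\cap O(v)|\neq 1$ and $|I(u)\cap I(v)|\neq 1$; out-quadrangular if the first condition holds for all distinct $u,v$; in-quadrangular if the second does. -}

module Defs where

open import Data.Nat using (ℕ; _+_; _*_; suc)
open import Data.Bool using (Bool; true; false; _∧_)
open import Data.Fin using (Fin)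
open import Data.Fin.Subset using (Subset; _∩_; ∣_∣)
open import Data.Vec using (tabulate)
open import Data.Product using (_×_; ∃)
open import Data.Sum using (_⊎_)
open import Relation.Binary.PropositionalEquality using (_≡_; _≢_)

-- A digraph on vertex set Fin n, given by its arc predicate:
-- arc u v ≡ true  iff  (u,v) is an arc.
Digraph : ℕ → Set
Digraph n = Fin n → Fin n → Bool

record IsTournament {n : ℕ} (T : Digraph n) : Set where
  field
    loopless : ∀ u → T u u ≡ false
    exactlyOne : ∀ u v → u ≢ v → (T u v ≡ true × T v u ≡ false) ⊎ (T u v ≡ false × T v u ≡ true)

O : ∀ {n} → Digraph n → Fin n → Subset n
O T v = tabulate (λ w → T v w)

I : ∀ {n} → Digraph n → Fin n → Subset n
I T v = tabulate (λ w → T w v)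

IsRegularTournament : ∀ {n} → Digraph n → Set
IsRegularTournament {n} T =
  IsTournament T × ∃ λ k → (n ≡ 2 * k + 1) × (∀ v → ∣ O T v ∣ ≡ k)

OutQuadrangular : ∀ {n} → Digraph n → Set
OutQuadrangular T = ∀ u v → u ≢ v → ∣ O T u ∩ O T v ∣ ≢ 1

InQuadrangular : ∀ {n} → Digraph n → Set
InQuadrangular T = ∀ u v → u ≢ v → ∣ I T u ∩ I T v ∣ ≢ 1

Quadrangular : ∀ {n} → Digraph n → Set
Quadrangular T = OutQuadrangular T × InQuadrangular T

{-# OPTIONS --safe #-}
-- Fix distinct u, v and sort every third vertex w by the arcs between w and {u, v}.
-- Counting the out-neighbours of v and the in-neighbours of u in this partition gives
--   d⁺(v) + |I(u) ∩ I(v)| = d⁻(u) + |O(u) ∩ O(v)|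
-- in every tournament. In a regular tournament d⁺(v) = d⁻(u) = k, so u and v have as
-- many common out-neighbours as common in-neighbours, and the two halves of
-- quadrangularity coincide.
module Submission where

open import Defs
open import Data.Nat using (ℕ; zero; suc; _+_; _*_)
open import Data.Nat.Properties using (+-*-semiring; +-cancelˡ-≡; +-cancelʳ-≡; +-identityʳ; *-identityˡ)
open import Data.Product using (_×_; _,_; proj₁; proj₂)
open import Data.Sum using (inj₁; inj₂)
open import Data.Bool using (Bool; true; false; _∧_; not)
open import Data.Bool.Properties using (∧-zeroʳ)
open import Data.Fin using (Fin; zero; suc; _≟_)
open import Data.Fin.Subset using (_∩_; ∣_∣)
open import Data.Vec using (tabulate; _∷_)
open import Relation.Nullary using (yes; no; does)
open import Relation.Nullary.Negation using (contradiction)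
open import Relation.Binary.PropositionalEquality using (_≡_; _≢_; refl; sym; trans; cong; module ≡-Reasoning)
open import Function.Bundles using (_⇔_; mk⇔; Equivalence)
open import Algebra.Properties.Semiring.Sum +-*-semiring
  using (sum; sum-syntax; sum-cong-≗; sum-replicate-zero; ∑-distrib-+; *-distribʳ-sum)

[_] : Bool → ℕ
[ true ] = 1
[ false ] = 0

∑-distrib-+₃ : ∀ {n} (f g h : Fin n → ℕ) →
  ∑[ i < n ] (f i + g i + h i) ≡ ∑[ i < n ] f i + ∑[ i < n ] g i + ∑[ i < n ] h i
∑-distrib-+₃ f g h =
  trans (∑-distrib-+ (λ i → f i + g i) h) (cong (_+ sum h) (∑-distrib-+ f g))

∑-1≡n : ∀ n → ∑[ i < n ] 1 ≡ n
∑-1≡n zero = refl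
∑-1≡n (suc n) = cong suc (∑-1≡n n)

∑-[x≟i]≡1 : ∀ {n} (x : Fin n) → ∑[ i < n ] [ does (x ≟ i) ] ≡ 1
∑-[x≟i]≡1 {suc n} zero = cong suc (sum-replicate-zero n)
∑-[x≟i]≡1 (suc x) = ∑-[x≟i]≡1 x

∑-[x≟i]*c≡c : ∀ {n} (x : Fin n) c → ∑[ i < n ] ([ does (x ≟ i) ] * c) ≡ c
∑-[x≟i]*c≡c x c = begin
  ∑[ i < _ ] ([ does (x ≟ i) ] * c)  ≡⟨ *-distribʳ-sum c (λ i → [ does (x ≟ i) ]) ⟨
  ∑[ i < _ ] [ does (x ≟ i) ] * c    ≡⟨ cong (_* c) (∑-[x≟i]≡1 x) ⟩
  1 * c                              ≡⟨ *-identityˡ c ⟩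
  c                                  ∎
  where open ≡-Reasoning

∣tabulate∣≡∑ : ∀ {n} (f : Fin n → Bool) → ∣ tabulate f ∣ ≡ ∑[ i < n ] [ f i ]
∣tabulate∣≡∑ {zero} f = refl
∣tabulate∣≡∑ {suc n} f with f zero
... | true = cong suc (∣tabulate∣≡∑ (λ i → f (suc i)))
... | false = ∣tabulate∣≡∑ (λ i → f (suc i))

tabulate-∩ : ∀ {n} (f g : Fin n → Bool) → tabulate f ∩ tabulate g ≡ tabulate (λ i → f i ∧ g i)
tabulate-∩ {zero} f g = refl
tabulate-∩ {suc n} f g = cong (f zero ∧ g zero ∷_) (tabulate-∩ (λ i → f (suc i)) (λ i → g (suc i)))

∣tabulate∩tabulate∣≡∑ : ∀ {n} (f g : Fin n → Bool) → ∣ tabulate f ∩ tabulate g ∣ ≡ ∑[ i < n ] [ f i ∧ g i ]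
∣tabulate∩tabulate∣≡∑ f g = trans (cong ∣_∣ (tabulate-∩ f g)) (∣tabulate∣≡∑ (λ i → f i ∧ g i))

module Degrees {n : ℕ} (T : Digraph n) where

  outdeg indeg : Fin n → ℕ
  outdeg u = ∑[ w < n ] [ T u w ]
  indeg u = ∑[ w < n ] [ T w u ]

  commonOut commonIn : Fin n → Fin n → ℕ
  commonOut u v = ∑[ w < n ] [ T u w ∧ T v w ]
  commonIn u v = ∑[ w < n ] [ T w u ∧ T w v ]

  ∣O∣≡outdeg : ∀ u → ∣ O T u ∣ ≡ outdeg u
  ∣O∣≡outdeg u = ∣tabulate∣≡∑ (T u)

module _ {n : ℕ} {T : Digraph n} (tournament : IsTournament T) where
  open IsTournament tournament
  open Degrees T

  converse : ∀ {u w} → u ≢ w → T w u ≡ not (T u w)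
  converse {u} {w} u≢w with exactlyOne u w u≢w
  ... | inj₁ (uw , wu) rewrite uw = wu
  ... | inj₂ (uw , wu) rewrite uw = wu

  arc-or-converse-or-equal : ∀ u w → [ T u w ] + [ T w u ] + [ does (u ≟ w) ] ≡ 1
  arc-or-converse-or-equal u w with u ≟ w
  ... | yes refl rewrite loopless u = refl
  ... | no u≢w rewrite converse u≢w with T u w
  ...   | true = refl
  ...   | false = refl

  outdeg+indeg : ∀ u → outdeg u + indeg u + 1 ≡ n
  outdeg+indeg u = begin
    outdeg u + indeg u + 1                            ≡⟨ cong (outdeg u + indeg u +_) (∑-[x≟i]≡1 u) ⟨
    outdeg u + indeg u + ∑[ w < n ] [ does (u ≟ w) ]  ≡⟨ ∑-distrib-+₃ {n} _ _ _ ⟨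
    ∑[ w < n ] ([ T u w ] + [ T w u ] + [ does (u ≟ w) ]) ≡⟨ sum-cong-≗ (arc-or-converse-or-equal u) ⟩
    ∑[ w < n ] 1                                      ≡⟨ ∑-1≡n n ⟩
    n                                                 ∎
    where open ≡-Reasoning

  -- The correction terms balance u ∈ O(v), counted on the left, against v ∈ I(u) on the right.
  partition-count : ∀ {u v} → u ≢ v → ∀ w →
    [ T v w ] + [ T w u ∧ T w v ] + [ does (v ≟ w) ] * [ T v u ]
      ≡ [ T w u ] + [ T u w ∧ T v w ] + [ does (u ≟ w) ] * [ T v u ]
  partition-count {u} {v} u≢v w with u ≟ w | v ≟ w
  ... | yes refl | yes refl = contradiction refl u≢v
  ... | yes refl | no _ rewrite loopless u with T v u
  ...   | true = refl
  ...   | false = refl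
  partition-count {u} {v} u≢v w | no _ | yes refl
    rewrite loopless v | ∧-zeroʳ (T v u) | ∧-zeroʳ (T u v) with T v u
  ...   | true = refl
  ...   | false = refl
  partition-count {u} {v} u≢v w | no u≢w | no v≢w
    rewrite converse u≢w | converse v≢w with T u w | T v w
  ...   | true | true = refl
  ...   | true | false = refl
  ...   | false | true = refl
  ...   | false | false = refl

  outdeg+commonIn : ∀ {u v} → u ≢ v → outdeg v + commonIn u v ≡ indeg u + commonOut u v
  outdeg+commonIn {u} {v} u≢v = +-cancelʳ-≡ [ T v u ] _ _ (begin
    outdeg v + commonIn u v + [ T v u ]                                   ≡⟨ cong (outdeg v + commonIn u v +_) (∑-[x≟i]*c≡c v _) ⟨
    outdeg v + commonIn u v + ∑[ w < n ] ([ does (v ≟ w) ] * [ T v u ])  ≡⟨ ∑-distrib-+₃ {n} _ _ _ ⟨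
    ∑[ w < n ] ([ T v w ] + [ T w u ∧ T w v ] + [ does (v ≟ w) ] * [ T v u ]) ≡⟨ sum-cong-≗ (partition-count u≢v) ⟩
    ∑[ w < n ] ([ T w u ] + [ T u w ∧ T v w ] + [ does (u ≟ w) ] * [ T v u ]) ≡⟨ ∑-distrib-+₃ {n} _ _ _ ⟩
    indeg u + commonOut u v + ∑[ w < n ] ([ does (u ≟ w) ] * [ T v u ])  ≡⟨ cong (indeg u + commonOut u v +_) (∑-[x≟i]*c≡c u _) ⟩
    indeg u + commonOut u v + [ T v u ]                                   ∎)
    where open ≡-Reasoning

  module _ {k : ℕ} (n≡2k+1 : n ≡ 2 * k + 1) (∣O∣≡k : ∀ v → ∣ O T v ∣ ≡ k) where

    outdeg≡k : ∀ u → outdeg u ≡ k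
    outdeg≡k u = trans (sym (∣O∣≡outdeg u)) (∣O∣≡k u)

    indeg≡k : ∀ u → indeg u ≡ k
    indeg≡k u = trans (+-cancelˡ-≡ k _ _ (+-cancelʳ-≡ 1 _ _ (begin
      k + indeg u + 1         ≡⟨ cong (λ d → d + indeg u + 1) (outdeg≡k u) ⟨
      outdeg u + indeg u + 1  ≡⟨ outdeg+indeg u ⟩
      n                       ≡⟨ n≡2k+1 ⟩
      k + (k + 0) + 1         ∎))) (+-identityʳ k)
      where open ≡-Reasoning

    commonOut≡commonIn : ∀ {u v} → u ≢ v → commonOut u v ≡ commonIn u v
    commonOut≡commonIn {u} {v} u≢v = sym (+-cancelˡ-≡ k _ _ (begin
      k + commonIn u v         ≡⟨ cong (_+ commonIn u v) (outdeg≡k v) ⟨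
      outdeg v + commonIn u v  ≡⟨ outdeg+commonIn u≢v ⟩
      indeg u + commonOut u v  ≡⟨ cong (_+ commonOut u v) (indeg≡k u) ⟩
      k + commonOut u v        ∎))
      where open ≡-Reasoning

∣O∩O∣≡∣I∩I∣ : ∀ {n} {T : Digraph n} → IsRegularTournament T →
  ∀ {u v} → u ≢ v → ∣ O T u ∩ O T v ∣ ≡ ∣ I T u ∩ I T v ∣
∣O∩O∣≡∣I∩I∣ {T = T} (tournament , k , n≡2k+1 , ∣O∣≡k) {u} {v} u≢v = begin
  ∣ O T u ∩ O T v ∣  ≡⟨ ∣tabulate∩tabulate∣≡∑ (T u) (T v) ⟩
  commonOut u v      ≡⟨ commonOut≡commonIn tournament n≡2k+1 ∣O∣≡k u≢v ⟩
  commonIn u v       ≡⟨ ∣tabulate∩tabulate∣≡∑ (λ w → T w u) (λ w → T w v) ⟨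
  ∣ I T u ∩ I T v ∣  ∎
  where
  open Degrees T
  open ≡-Reasoning

OutQuadrangular⇔InQuadrangular : ∀ {n} {T : Digraph n} →
  (∀ {u v} → u ≢ v → ∣ O T u ∩ O T v ∣ ≡ ∣ I T u ∩ I T v ∣) →
  OutQuadrangular T ⇔ InQuadrangular T
OutQuadrangular⇔InQuadrangular ∣O∩O∣≡∣I∩I∣ = mk⇔
  (λ out u v u≢v ∣I∩I∣≡1 → out u v u≢v (trans (∣O∩O∣≡∣I∩I∣ u≢v) ∣I∩I∣≡1))
  (λ inn u v u≢v ∣O∩O∣≡1 → inn u v u≢v (trans (sym (∣O∩O∣≡∣I∩I∣ u≢v)) ∣O∩O∣≡1))

theorem15 : ∀ {n : ℕ} (T : Digraph n) → IsRegularTournament T →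
    (Quadrangular T ⇔ OutQuadrangular T) × (Quadrangular T ⇔ InQuadrangular T)
theorem15 T regular =
  mk⇔ proj₁ (λ out → out , to out) ,
  mk⇔ proj₂ (λ inn → from inn , inn)
  where open Equivalence (OutQuadrangular⇔InQuadrangular (∣O∩O∣≡∣I∩I∣ regular))
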